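{- Let $t<m$ be positive integers and let the vertex set be $\binom{[m]}{t}$, identified with the set of $0/1$ vectors $v=(v(1),\ldots,v(m))$ with exactly $t$ ones (characteristic vectors). Order these vectors by $v<w$ iff $v(i)=0$ and $w(i)=1$, where $i$ is the smallest index at which $v$ and $w$ differ. For each $B\in\binom{[m]}{t}$ fix an arbitrary bijection $f_B:2^B\to[2^t]$. For $v<w$ with $v,w$ the characteristic vectors of sets $S,T$, define $c_1(vw)=\min\{i: v(i)=0,\ w(i)=1\}$, $c_2(vw)=\min\{j: j>c_1(vw),\ v(j)=1,\ w(j)=0\}$, $c_3(vw)=f_S(S\cap T)$, $c_4(vw)=f_T(S\cap T)$, and $\sigma(vw)=(c_1(vw),c_2(vw),c_3(vw),c_4(vw))$, an edge-coloring of the complete graph on this vertex set. Then: 1) If $v<w<x$, then $\sigma(vw)\ne\sigma(wx)$. 2) If $v<w<\min\{x,y\}$ and $\sigma(vw)=\sigma(vx)$, then $\sigma(vy)\ne\sigma(wx)$. 3) If $v<w<x<y$ with $\sigma(vw)=\sigma(xy)$, then $\sigma(vx)\ne\sigma(vy)$.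
   Context: $[m]=\{1,\ldots,m\}$, $\binom{[m]}{t}$ is the family of $t$-element subsets of $[m]$, and $2^B$ is the power set of $B$. For an edge $\{v,w\}$ the color $\sigma(vw)$ is always computed with the smaller vertex (in the stated order) written first. -}

module Defs where

open import Data.Nat using (ℕ; zero; suc; _^_; _<ᵇ_)
open import Data.Bool using (Bool; true; false; not; _∧_; if_then_else_)
open import Data.Fin using (Fin; toℕ) renaming (zero to fzero; suc to fsuc; _<_ to _<ᶠ_)
open import Data.Fin.Subset using (Subset; _∩_; _⊆_; ∣_∣)
open import Data.Vec using (lookup)
open import Data.Maybe using (Maybe; just; nothing; maybe)
import Data.Maybe as Maybe
open import Data.Product using (Σ; _×_; _,_)
open import Relation.Binary.PropositionalEquality using (_≡_)

-- Characteristic vectors: Subset m = Vec Bool m, true = 1 (inside), false = 0.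

_≺_ : ∀ {m} → Subset m → Subset m → Set
_≺_ {m} v w = Σ (Fin m) λ i →
  (∀ j → j <ᶠ i → lookup v j ≡ lookup w j) × (lookup v i ≡ false) × (lookup w i ≡ true)

firstWhere : ∀ {m} → (Fin m → Bool) → Maybe (Fin m)
firstWhere {zero} p = nothing
firstWhere {suc m} p = if p fzero then just fzero else Maybe.map fsuc (firstWhere (λ i → p (fsuc i)))

c₁ : ∀ {m} → Subset m → Subset m → Maybe (Fin m)
c₁ v w = firstWhere (λ i → not (lookup v i) ∧ lookup w i)

c₂ : ∀ {m} → Subset m → Subset m → Maybe (Fin m)
c₂ v w = maybe (λ c → firstWhere (λ j → (toℕ c <ᵇ toℕ j) ∧ (lookup v j ∧ not (lookup w j)))) nothing (c₁ v w)

-- A family f with f B : 2^B → [2^t] (values of f B outside 2^B are irrelevant);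
-- Fin (2 ^ t) stands for [2^t].
Labelling : ℕ → ℕ → Set
Labelling m t = Subset m → Subset m → Fin (2 ^ t)

IsBijOnPowerset : ∀ m t → Labelling m t → Subset m → Set
IsBijOnPowerset m t f B =
  (∀ X Y → X ⊆ B → Y ⊆ B → f B X ≡ f B Y → X ≡ Y) ×
  (∀ (k : Fin (2 ^ t)) → Σ (Subset m) λ X → (X ⊆ B) × (f B X ≡ k))

Colour : ℕ → ℕ → Set
Colour m t = Maybe (Fin m) × Maybe (Fin m) × Fin (2 ^ t) × Fin (2 ^ t)

σ : ∀ m t → Labelling m t → Subset m → Subset m → Colour m t
σ m t f v w = c₁ v w , c₂ v w , f v (v ∩ w) , f w (v ∩ w)

module Submission where

-- For v ≺ w write i(vw) for the first index where v and w
-- differ; it is exactly the value of c₁ (lemma c₁-at), so equal first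
-- colour components force equal first-difference indices.  Along a chain
-- v ≺ w ≺ x the first difference of v and x is the smaller of i(vw) and
-- i(wx), and these two never coincide (diffAt-trans).
--   1) σ(vw) = σ(wx) would give i(vw) = i(wx), but w is 1 at i(vw) and 0
--      at i(wx).
--   2) σ(vw) = σ(vx) forces i(vw) < i(wx); then σ(vy) = σ(wx) asks
--      i(vy) = min(i(vw), i(wy)) ≤ i(vw) to equal i(wx), impossible.
--   3) For sets of equal size c₂(vw) exists (otherwise v ⊊ w); call it b.
--      Then v(b) = 1, and c₂(xy) = b gives x(b) = 1, y(b) = 0.  But
--      c₃(vx) = c₃(vy) and injectivity of f_v give v ∩ x = v ∩ y, which
--      disagree at b.
-- The file first characterises firstWhere, then the first-difference
-- index and c₁, then c₂, and finally assembles the three claims.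

open import Defs
open import Data.Nat using (ℕ; suc; _<_; _<ᵇ_; z<s; s<s)
open import Data.Nat.Properties using (<⇒<ᵇ) renaming (<-irrefl to ℕ-<-irrefl)
open import Data.Fin using (Fin; toℕ) renaming (zero to fzero; suc to fsuc; _<_ to _<ᶠ_)
open import Data.Fin.Properties using (<-cmp; <-irrefl; <-trans)
open import Data.Fin.Subset using (Subset; ∣_∣; _∩_; _⊆_; _⊂_)
open import Data.Fin.Subset.Properties using (p∩q⊆p; p⊂q⇒∣p∣<∣q∣)
open import Data.Vec using (lookup)
open import Data.Vec.Properties using (lookup-zipWith; []=⇒lookup; lookup⇒[]=)
open import Data.Bool using (Bool; true; false; not; _∧_; T)
open import Data.Bool.Properties using (∧-inverseˡ)
open import Data.Maybe using (just; nothing)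
open import Data.Maybe.Properties using (just-injective)
open import Data.Product using (Σ; _×_; _,_; proj₁; proj₂)
open import Data.Sum using (_⊎_; inj₁; inj₂)
open import Data.Empty using (⊥-elim)
open import Relation.Binary using (tri<; tri≈; tri>)
open import Relation.Binary.PropositionalEquality
  using (_≡_; _≢_; refl; sym; trans; cong; cong₂; module ≡-Reasoning)

true≢false : true ≢ false
true≢false ()

firstWhere-sound : ∀ {m} (p : Fin m → Bool) {i} → firstWhere p ≡ just i → p i ≡ true
firstWhere-sound {suc m} p eq with p fzero in p0
firstWhere-sound {suc m} p refl | true = p0
firstWhere-sound {suc m} p eq | false with firstWhere (λ i → p (fsuc i)) in rest
firstWhere-sound {suc m} p refl | false | just j = firstWhere-sound (λ i → p (fsuc i)) rest

firstWhere-nothing : ∀ {m} (p : Fin m → Bool) → firstWhere p ≡ nothing → ∀ j → p j ≡ false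
firstWhere-nothing {suc m} p eq j with p fzero in p0
firstWhere-nothing {suc m} p () j | true
firstWhere-nothing {suc m} p eq j | false with firstWhere (λ i → p (fsuc i)) in rest
firstWhere-nothing {suc m} p eq fzero | false | nothing = p0
firstWhere-nothing {suc m} p eq (fsuc j) | false | nothing =
  firstWhere-nothing (λ i → p (fsuc i)) rest j

firstWhere-least : ∀ {m} (p : Fin m → Bool) (d : Fin m) → p d ≡ true →
  (∀ j → j <ᶠ d → p j ≡ false) → firstWhere p ≡ just d
firstWhere-least {suc m} p fzero pd _ rewrite pd = refl
firstWhere-least {suc m} p (fsuc d) pd below
  rewrite below fzero z<s
        | firstWhere-least (λ i → p (fsuc i)) d pd (λ j j<d → below (fsuc j) (s<s j<d)) = refl

DiffersFirstAt : ∀ {m} → Subset m → Subset m → Fin m → Set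
DiffersFirstAt v w i =
  (∀ j → j <ᶠ i → lookup v j ≡ lookup w j) × (lookup v i ≡ false) × (lookup w i ≡ true)

c₁-at : ∀ {m} (v w : Subset m) {i} → DiffersFirstAt v w i → c₁ v w ≡ just i
c₁-at v w {i} (agree , vi≡0 , wi≡1) =
  firstWhere-least _ i new-in-w (λ j j<i → same-in-both (agree j j<i))
  where
  new-in-w : not (lookup v i) ∧ lookup w i ≡ true
  new-in-w rewrite vi≡0 | wi≡1 = refl
  same-in-both : ∀ {a b} → a ≡ b → not a ∧ b ≡ false
  same-in-both {a} refl = ∧-inverseˡ a

index-from-c₁ : ∀ {m} (v w x y : Subset m) {i j} →
  DiffersFirstAt v w i → DiffersFirstAt x y j → c₁ v w ≡ c₁ x y → i ≡ j
index-from-c₁ v w x y vw xy eq = just-injective (trans (sym (c₁-at v w vw)) (trans eq (c₁-at x y xy)))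

diffAt-trans : ∀ {m} (v w x : Subset m) {i j} →
  DiffersFirstAt v w i → DiffersFirstAt w x j →
  (i <ᶠ j × DiffersFirstAt v x i) ⊎ (j <ᶠ i × DiffersFirstAt v x j)
diffAt-trans v w x {i} {j} (avw , vi , wi) (awx , wj , xj) with <-cmp i j
... | tri< i<j _ _ =
  inj₁ (i<j , (λ k k<i → trans (avw k k<i) (awx k (<-trans k<i i<j))) , vi , trans (sym (awx i i<j)) wi)
... | tri≈ _ refl _ = ⊥-elim (true≢false (trans (sym wi) wj))
... | tri> _ _ j<i =
  inj₂ (j<i , (λ k k<j → trans (avw k (<-trans k<j j<i)) (awx k k<j)) , trans (avw j j<i) wj , xj)

c₂-pred : ∀ {m} → Fin m → Subset m → Subset m → Fin m → Bool
c₂-pred c v w j = (toℕ c <ᵇ toℕ j) ∧ (lookup v j ∧ not (lookup w j))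

c₂-at : ∀ {m} (v w : Subset m) {i} → DiffersFirstAt v w i → c₂ v w ≡ firstWhere (c₂-pred i v w)
c₂-at v w vw rewrite c₁-at v w vw = refl

c₂-sound : ∀ {m} (v w : Subset m) {b} → c₂ v w ≡ just b → lookup v b ≡ true × lookup w b ≡ false
c₂-sound v w {b} eq with c₁ v w
... | just c = split (toℕ c <ᵇ toℕ b) (lookup v b) (lookup w b) (firstWhere-sound (c₂-pred c v w) eq)
  where
  split : ∀ lt a b → lt ∧ (a ∧ not b) ≡ true → a ≡ true × b ≡ false
  split true true false _ = refl , refl
c₂-sound v w () | nothing

⊂-if-nothing-beyond : ∀ {m} (v w : Subset m) {i} → DiffersFirstAt v w i →
  (∀ j → i <ᶠ j → lookup v j ≡ true → lookup w j ≡ true) → v ⊂ w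
⊂-if-nothing-beyond v w {i} (agree , vi , wi) beyond =
  (λ {j} j∈v → lookup⇒[]= j w (stays-in-w j ([]=⇒lookup j∈v))) ,
  i , lookup⇒[]= i w wi , (λ i∈v → true≢false (trans (sym ([]=⇒lookup i∈v)) vi))
  where
  stays-in-w : ∀ j → lookup v j ≡ true → lookup w j ≡ true
  stays-in-w j vj with <-cmp j i
  ... | tri< j<i _ _ = trans (sym (agree j j<i)) vj
  ... | tri≈ _ refl _ = ⊥-elim (true≢false (trans (sym vj) vi))
  ... | tri> _ _ i<j = beyond j i<j vj

c₂-exists : ∀ {m} (v w : Subset m) → ∣ v ∣ ≡ ∣ w ∣ → v ≺ w → Σ (Fin m) λ b → c₂ v w ≡ just b
c₂-exists v w same-size (i , vw) rewrite c₂-at v w vw with firstWhere (c₂-pred i v w) in search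
... | just b = b , refl
... | nothing = ⊥-elim (ℕ-<-irrefl same-size (p⊂q⇒∣p∣<∣q∣ (⊂-if-nothing-beyond v w vw beyond)))
  where
  in-w : ∀ {lt a b} → T lt → a ≡ true → lt ∧ (a ∧ not b) ≡ false → b ≡ true
  in-w {true} {true} {true} _ _ _ = refl
  beyond : ∀ j → i <ᶠ j → lookup v j ≡ true → lookup w j ≡ true
  beyond j i<j vj = in-w (<⇒<ᵇ i<j) vj (firstWhere-nothing (c₂-pred i v w) search j)

-- Claim 1: along v ≺ w ≺ x the colours σ(vw), σ(wx) already differ in c₁,
-- since w is 1 at i(vw) but 0 at i(wx).
σ-path-distinct : ∀ m t (f : Labelling m t) (v w x : Subset m) →
  v ≺ w → w ≺ x → σ m t f v w ≢ σ m t f w x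
σ-path-distinct m t f v w x (i , vw) (k , wx) e =
  true≢false (trans (sym (proj₂ (proj₂ vw))) (trans (cong (lookup w) i≡k) (proj₁ (proj₂ wx))))
  where
  i≡k : i ≡ k
  i≡k = index-from-c₁ v w w x vw wx (cong proj₁ e)

-- Claim 2 only needs c₁: σ(vw) = σ(vx) forces i(vw) < i(wx), while
-- σ(vy) = σ(wx) would need i(vy) = i(wx) although i(vy) ≤ i(vw).
σ-fork-distinct : ∀ m t (f : Labelling m t) (v w x y : Subset m) →
  v ≺ w → w ≺ x → w ≺ y → σ m t f v w ≡ σ m t f v x → σ m t f v y ≢ σ m t f w x
σ-fork-distinct m t f v w x y (i , vw) (j , wx) (k , wy) e₁ e₂
  with diffAt-trans v w x vw wx | diffAt-trans v w y vw wy
... | inj₂ (j<i , vx) | _ = <-irrefl (sym (index-from-c₁ v w v x vw vx (cong proj₁ e₁))) j<i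
... | inj₁ (i<j , _) | inj₁ (_ , vy) = <-irrefl (index-from-c₁ v y w x vy wx (cong proj₁ e₂)) i<j
... | inj₁ (i<j , _) | inj₂ (k<i , vy) =
  <-irrefl (index-from-c₁ v y w x vy wx (cong proj₁ e₂)) (<-trans k<i i<j)

-- Claim 3 (for |v| = |w| and f_v injective on 2^v): b = c₂(vw) = c₂(xy)
-- lies in v and x but not y, so v ∩ x ≠ v ∩ y, hence c₃(vx) ≠ c₃(vy).
σ-c₂-distinct : ∀ m t (f : Labelling m t) (v w x y : Subset m) → ∣ v ∣ ≡ ∣ w ∣ →
  (∀ X Y → X ⊆ v → Y ⊆ v → f v X ≡ f v Y → X ≡ Y) → v ≺ w →
  σ m t f v w ≡ σ m t f x y → σ m t f v x ≢ σ m t f v y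
σ-c₂-distinct m t f v w x y same-size f-injective vw e₁ e₂
  with c₂-exists v w same-size vw
... | b , c₂vw≡b = true≢false (begin
    true                      ≡⟨ sym (cong₂ _∧_ b∈v b∈x) ⟩
    lookup v b ∧ lookup x b   ≡⟨ sym (lookup-zipWith _∧_ b v x) ⟩
    lookup (v ∩ x) b          ≡⟨ cong (λ s → lookup s b) v∩x≡v∩y ⟩
    lookup (v ∩ y) b          ≡⟨ lookup-zipWith _∧_ b v y ⟩
    lookup v b ∧ lookup y b   ≡⟨ cong₂ _∧_ b∈v b∉y ⟩
    false                     ∎)
  where
  open ≡-Reasoning
  b∈v : lookup v b ≡ true
  b∈v = proj₁ (c₂-sound v w c₂vw≡b)
  c₂xy≡b : c₂ x y ≡ just b
  c₂xy≡b = trans (sym (cong (λ s → proj₁ (proj₂ s)) e₁)) c₂vw≡b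
  b∈x : lookup x b ≡ true
  b∈x = proj₁ (c₂-sound x y c₂xy≡b)
  b∉y : lookup y b ≡ false
  b∉y = proj₂ (c₂-sound x y c₂xy≡b)
  v∩x≡v∩y : v ∩ x ≡ v ∩ y
  v∩x≡v∩y = f-injective (v ∩ x) (v ∩ y) (p∩q⊆p v x) (p∩q⊆p v y)
    (cong (λ s → proj₁ (proj₂ (proj₂ s))) e₂)

mainTheorem2 : (m t : ℕ) → 0 < t → t < m →
    (f : Labelling m t) →
    (∀ (B : Subset m) → ∣ B ∣ ≡ t → IsBijOnPowerset m t f B) →
    (∀ (v w x : Subset m) → ∣ v ∣ ≡ t → ∣ w ∣ ≡ t → ∣ x ∣ ≡ t →
      v ≺ w → w ≺ x → σ m t f v w ≢ σ m t f w x)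
    ×
    (∀ (v w x y : Subset m) → ∣ v ∣ ≡ t → ∣ w ∣ ≡ t → ∣ x ∣ ≡ t → ∣ y ∣ ≡ t →
      v ≺ w → w ≺ x → w ≺ y → σ m t f v w ≡ σ m t f v x → σ m t f v y ≢ σ m t f w x)
    ×
    (∀ (v w x y : Subset m) → ∣ v ∣ ≡ t → ∣ w ∣ ≡ t → ∣ x ∣ ≡ t → ∣ y ∣ ≡ t →
      v ≺ w → w ≺ x → x ≺ y → σ m t f v w ≡ σ m t f x y → σ m t f v x ≢ σ m t f v y)
mainTheorem2 m t _ _ f bijective =
  (λ v w x _ _ _ → σ-path-distinct m t f v w x) ,
  (λ v w x y _ _ _ _ → σ-fork-distinct m t f v w x y) ,
  (λ v w x y ∣v∣≡t ∣w∣≡t _ _ vw _ _ →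
    σ-c₂-distinct m t f v w x y (trans ∣v∣≡t (sym ∣w∣≡t)) (proj₁ (bijective v ∣v∣≡t)) vw)
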